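{- Let $K$ be a semifield, $P$ a polygon with vertex set $V$, and $D$ a dissection of $P$ of the form $D=\{d\}\sqcup D_2$, where $d=\{\zeta,\eta\}$ divides $P$ into subpolygons $P_1$ (vertex set $\{\varepsilon\in V : \zeta\le\varepsilon\le\eta\}$) and $P_2$ (vertex set $\{\varepsilon\in V:\eta\le\varepsilon\le\zeta\}$), and $D_2$ is a dissection of $P_2$. Let $U_1=\{\varepsilon\in V:\zeta<\varepsilon<\eta\}$, $U_2=\{\varepsilon\in V:\eta<\varepsilon<\zeta\}$, $\alpha\in U_1$, $\beta\in U_2$, and let $f:\operatorname{diag}(P)\to K$ be a map. Then: (i) The formula $R(\alpha,\zeta,\pi_3,\dots,\pi_p)=(\eta,\zeta,\pi_3,\dots,\pi_p)$ defines a bijection $R$ from the set of $T$-paths $\pi\in\mathcal{T}_{P,D}(\alpha,\beta)$ with $\pi_1=\alpha$, $\pi_2=\zeta$, $\pi_3\neq\eta$ onto the set of $T$-paths $\rho\in\mathcal{T}_{P,D}(\eta,\beta)$ with $\rho_1=\eta$, $\rho_2=\zeta$, and it satisfies $\frac{f(\alpha,\zeta)}{f(\eta,\zeta)}\,f(R(\pi))=f(\pi)$. (ii) The formula $S(\alpha,\zeta,\eta,\pi_4,\dots,\pi_p)=(\eta,\pi_4,\dots,\pi_p)$ defines a bijection $S$ from the set of $T$-paths $\pi\in\mathcal{T}_{P,D}(\alpha,\beta)$ with $\pi_1=\alpha$, $\pi_2=\zeta$, $\pi_3=\eta$ onto the set of $T$-paths $\sigma\in\mathcal{T}_{P,D}(\eta,\beta)$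 with $\sigma_1=\eta$, $\sigma_2\neq\zeta$, and it satisfies $\frac{f(\alpha,\zeta)}{f(\zeta,\eta)}\,f(S(\pi))=f(\pi)$.
   Context: A semifield is a set $K$ with binary operations $+$ and $\cdot$ such that $+$ is associative and commutative, $(K,\cdot)$ is a commutative group ($x/y:=xy^{ -1}$), and $\cdot$ distributes over $+$. A polygon $P$ is a finite set $V$ of at least three vertices with a cyclic order, pictured as a convex polygon in the plane; $\zeta\le\varepsilon\le\eta$ means $\varepsilon$ lies on the arc of the cyclic order going from $\zeta$ to $\eta$ in the positive direction, endpoints included, and strict inequality excludes the endpoints. A subpolygon is a subset of $V$ with at least three vertices and the induced cyclic order. A diagonal is a two-element subset of $V$; $\operatorname{diag}(P)$ is the set of diagonals; $f(\alpha,\beta):=f(\{\alpha,\beta\})$. Edges are $\{\alpha,\alpha^+\}$; other diagonals are internal. Diagonals $\{\alpha,\beta\}$, $\{\gamma,\delta\}$ cross if the four vertices are distinct and appear in cyclic order $\alpha,\gamma,\beta,\delta$ or $\alpha,\delta,\beta,\gamma$. A dissection is a set of pairwise non-crossing internal diagonals. For vertices $\pi_1\neq\pi_p$, a $T$-path from $\pi_1$ to $\pi_p$ with respect to $D$ is a tuple $(\pi_1,\dots,\pi_p)$ of vertices such that: (i) $\{\pi_1,\pi_2\},\dots,\{\pi_{p-1},\pi_p\}$ are pairwise different diagonals; (ii) no $\{\pi_i,\pi_{i+1}\}$ crosses a diagonal of $D$; (iii) each $\{\pi_{2j},\pi_{2j+1}\}$ lies in $D$, and these diagonals cross $\{\pi_1,\pi_p\}$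 at pairwise different points progressing monotonically in the direction from $\pi_1$ to $\pi_p$. $\mathcal{T}_{P,D}(\alpha,\beta)$ is the set of $T$-paths from $\alpha$ to $\beta$. For a $T$-path $\pi$, $f(\pi) := \prod_{i\text{ odd}} f(\pi_i,\pi_{i+1}) \big/ \prod_{j\text{ even}} f(\pi_j,\pi_{j+1})$. -}

module Defs where

open import Level using (Level; 0ℓ) renaming (suc to lsuc)
open import Data.Nat as ℕ using (ℕ; zero; suc; _∸_; _≤ᵇ_)
open import Data.Bool using (if_then_else_)
open import Data.Fin as Fin using (Fin; toℕ)
open import Data.Fin.Properties using (<-cmp)
open import Data.List using (List; []; _∷_; drop; head; last)
open import Data.List.Relation.Unary.All using (All)
open import Data.List.Relation.Unary.AllPairs using (AllPairs)
open import Data.Maybe using (Maybe; just; nothing)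
open import Data.Product using (Σ; _×_; _,_; proj₁; proj₂)
open import Data.Sum using (_⊎_)
open import Relation.Nullary using (¬_)
open import Data.Unit using (⊤)
open import Relation.Binary using (tri<; tri≈; tri>)
open import Relation.Binary.PropositionalEquality using (_≡_; _≢_)

record Semifield (c : Level) : Set (lsuc c) where
  infixl 7 _*_ _/_
  infixl 6 _+_
  field
    Carrier   : Set c
    _+_       : Carrier → Carrier → Carrier
    _*_       : Carrier → Carrier → Carrier
    1#        : Carrier
    _⁻¹       : Carrier → Carrier
    +-assoc   : ∀ x y z → (x + y) + z ≡ x + (y + z)
    +-comm    : ∀ x y → x + y ≡ y + x
    *-assoc   : ∀ x y z → (x * y) * z ≡ x * (y * z)
    *-comm    : ∀ x y → x * y ≡ y * x
    *-identityˡ : ∀ x → 1# * x ≡ x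
    *-inverseˡ  : ∀ x → (x ⁻¹) * x ≡ 1#
    *-distribˡ-+ : ∀ x y z → x * (y + z) ≡ (x * y) + (x * z)

  _/_ : Carrier → Carrier → Carrier
  x / y = x * (y ⁻¹)

-- Polygon: vertex set Fin n with the cyclic order i ↦ i+1 (mod n)

-- number of positive steps from a to b
dist : (n : ℕ) → Fin n → Fin n → ℕ
dist n a b = if toℕ a ≤ᵇ toℕ b then toℕ b ∸ toℕ a else (n ∸ toℕ a) ℕ.+ toℕ b

-- z ≤ e ≤ h  (e on the positive arc from z to h, endpoints included)
Btw≤ : {n : ℕ} → Fin n → Fin n → Fin n → Set
Btw≤ {n} z e h = dist n z e ℕ.≤ dist n z h

Btw< : {n : ℕ} → Fin n → Fin n → Fin n → Set
Btw< {n} z e h = (0 ℕ.< dist n z e) × (dist n z e ℕ.< dist n z h)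

-- diagonals = two-element subsets {lo, hi}, lo < hi
record Diag (n : ℕ) : Set where
  constructor diag
  field
    lo   : Fin n
    hi   : Fin n
    lo<hi : lo Fin.< hi

endpts : {n : ℕ} → Diag n → Fin n × Fin n
endpts (diag a b _) = a , b

SameDiag : {n : ℕ} → Fin n × Fin n → Fin n × Fin n → Set
SameDiag (a , b) (c , d) = (a ≡ c × b ≡ d) ⊎ (a ≡ d × b ≡ c)

-- crossing of {a,b} and {c,d}: cyclic order a,c,b,d or a,d,b,c
Cross : {n : ℕ} → Fin n × Fin n → Fin n × Fin n → Set
Cross (a , b) (c , d) = (Btw< a c b × Btw< b d a) ⊎ (Btw< a d b × Btw< b c a)

-- subpolygons are given by their vertex set W ⊆ Fin n (induced cyclic order)
-- {a,b} is an edge of W: no vertex of W strictly between a and b on one side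
IsEdgeIn : {n : ℕ} → (Fin n → Set) → Fin n → Fin n → Set
IsEdgeIn W a b = (∀ v → W v → ¬ Btw< a v b) ⊎ (∀ v → W v → ¬ Btw< b v a)

IsDissection : {n : ℕ} → (Fin n → Set) → (Diag n → Set) → Set
IsDissection {n} W D =
  (∀ e → D e → W (Diag.lo e) × W (Diag.hi e) × ¬ IsEdgeIn W (Diag.lo e) (Diag.hi e))
  × (∀ e e′ → D e → D e′ → ¬ Cross (endpts e) (endpts e′))

AllV : {n : ℕ} → Fin n → Set
AllV _ = ⊤

steps : {A : Set} → List A → List (A × A)
steps (x ∷ y ∷ r) = (x , y) ∷ steps (y ∷ r)
steps _ = []

-- entries at positions 2,4,6,... (1-indexed)
evens : {A : Set} → List A → List A
evens (_ ∷ y ∷ r) = y ∷ evens r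
evens _ = []

-- 0-indexed lookup
at : {A : Set} → List A → ℕ → Maybe A
at [] _ = nothing
at (x ∷ _) zero = just x
at (_ ∷ xs) (suc k) = at xs k

InD : {n : ℕ} → (Diag n → Set) → Fin n × Fin n → Set
InD {n} D s = Σ (Diag n) λ e → D e × SameDiag (endpts e) s

SameSide : {n : ℕ} → Fin n → Fin n → Fin n → Fin n → Set
SameSide a b x v = (Btw< a x b × Btw< a v b) ⊎ (Btw< b x a × Btw< b v a)

-- for diagonals s, t both crossing a diagonal starting at α (and not crossing
-- each other), the crossing point of s comes strictly before that of t in the
-- direction away from α: t ≠ s lies in the closed side of s not containing α
Before : {n : ℕ} → Fin n → Fin n × Fin n → Fin n × Fin n → Set
Before α (a , b) (c , d) =
  ¬ SameDiag (a , b) (c , d) × ¬ SameSide a b α c × ¬ SameSide a b α d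

IsTPath : {n : ℕ} → (Diag n → Set) → Fin n → Fin n → List (Fin n) → Set
IsTPath D α β π =
  α ≢ β × head π ≡ just α × last π ≡ just β
  -- (i) the steps are diagonals, pairwise different
  × All (λ s → proj₁ s ≢ proj₂ s) (steps π)
  × AllPairs (λ s t → ¬ SameDiag s t) (steps π)
  -- (ii) no step crosses a diagonal of D
  × All (λ s → ∀ e → D e → ¬ Cross s (endpts e)) (steps π)
  -- (iii) even steps lie in D, cross {α,β}, at points progressing from α to β
  × All (λ s → InD D s × Cross s (α , β)) (evens (steps π))
  × AllPairs (Before α) (evens (steps π))

module _ {c : Level} (K : Semifield c) {n : ℕ} (f : Diag n → Semifield.Carrier K) where
  open Semifield K

  -- f on ordered pairs (junk value 1# on a degenerate pair a = a)
  fp : Fin n → Fin n → Carrier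
  fp a b with <-cmp a b
  ... | tri< a<b _ _ = f (diag a b a<b)
  ... | tri≈ _ _ _   = 1#
  ... | tri> _ _ b<a = f (diag b a b<a)

  -- (product over odd-position steps , product over even-position steps)
  altProd : List (Fin n × Fin n) → Carrier × Carrier
  altProd [] = 1# , 1#
  altProd ((a , b) ∷ r) = fp a b * proj₂ (altProd r) , proj₁ (altProd r)

  weight : List (Fin n) → Carrier
  weight π = proj₁ (altProd (steps π)) / proj₂ (altProd (steps π))

BijectsOn : {A : Set} → (A → Set) → (A → Set) → (A → A) → Set
BijectsOn {A} Src Tgt F =
  (∀ x → Src x → Tgt (F x))
  × (∀ x y → Src x → Src y → F x ≡ F y → x ≡ y)
  × (∀ y → Tgt y → Σ A λ x → Src x × F x ≡ y)

Rmap : {n : ℕ} → Fin n → List (Fin n) → List (Fin n)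
Rmap η π = η ∷ drop 1 π

Smap : {n : ℕ} → Fin n → List (Fin n) → List (Fin n)
Smap η π = η ∷ drop 3 π

module Submission where

-- Every diagonal of D has its endpoints
-- in P₂.  The whole proof rests on one geometric fact: for every even step
-- s of the T-paths involved, α and η lie on the same side of s.  Given it,
-- "s crosses {α, β}" and "s crosses {η, β}" are equivalent, and so is the
-- monotonicity condition seen from α or from η; replacing the first vertex
-- (R) or dropping / restoring the two steps α ζ η (S) therefore preserves the
-- T-path conditions.  The same-side fact comes from an arc lemma: if x, y lie
-- on an arc of the cycle and a chord {c, e} avoids that arc, then x and y
-- are on the same side of the chord.

open import Defs
open import Level using (Level)
open import Function using (_∘_)
open import Data.Nat using (ℕ; zero; suc; _+_; _∸_; _≤_; _<_; _≤ᵇ_; _≤?_; z≤n; s≤s)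
open import Data.Nat.Properties
  using (+-assoc; +-comm; +-identityʳ; +-cancelʳ-<; +-cancelʳ-≡; +-cancelˡ-<; +-cancelˡ-≡; +-monoʳ-<; +-monoˡ-<;
         +-commutativeSemigroup; <-asym; <-cmp; <-irrefl; <-trans; <-≤-trans; <⇒≤; <⇒≱; >⇒≢; m∸n+n≡m; m≤m+n;
         n≢0⇒n>0; n≮0; ≤-<-trans; ≤-refl; ≤-reflexive; ≤-trans; ≤ᵇ⇒≤; ≤⇒≤ᵇ; ≤∧≢⇒<; ≮⇒≥; ≰⇒>)
open import Algebra.Bundles using (AbelianGroup)
import Algebra.Properties.AbelianGroup as AbelianGroupProperties
import Algebra.Properties.CommutativeSemigroup as CommSemigroupProperties
import Algebra.Properties.Group as GroupProperties
open CommSemigroupProperties +-commutativeSemigroup using (xy∙z≈xz∙y)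
open import Data.Bool using (true; false; T)
open import Data.Fin using (Fin; toℕ)
open import Data.Fin.Properties as FinP using (toℕ-injective; toℕ<n)
open import Data.List using (List; []; _∷_; _++_; drop; last)
open import Data.List.Properties using (∷-injectiveʳ)
open import Data.List.Relation.Unary.All as All using (All; []; _∷_)
open import Data.List.Relation.Unary.AllPairs as AllPairs using (AllPairs; []; _∷_)
open import Data.Maybe using (just)
open import Data.Maybe.Properties using (just-injective)
open import Data.Product using (Σ; _×_; _,_; proj₁; proj₂)
open import Data.Sum using (_⊎_; inj₁; inj₂; [_,_]′)
open import Relation.Nullary using (¬_; yes; no; contradiction)
open import Relation.Binary using (tri<; tri≈; tri>)
open import Relation.Binary.PropositionalEquality

-- `CycDist n A B d`: d is the length of the positive walk from A to B on
-- the n-cycle with vertices 0, …, n-1, i.e. d ≡ B - A (mod n).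
CycDist : ℕ → ℕ → ℕ → ℕ → Set
CycDist n A B d = (A ≤ B → d + A ≡ B) × (B < A → d + A ≡ n + B)

offset-< : ∀ {x y A U V} → x + A ≡ U → y + A ≡ V → U < V → x < y
offset-< {x} {y} {A} refl refl = +-cancelʳ-< A x y

offset-≡ : ∀ {x y A U V} → x + A ≡ U → y + A ≡ V → U ≡ V → x ≡ y
offset-≡ {x} {y} {A} refl refl = +-cancelʳ-≡ A x y

cycDist-self : ∀ {n A d} → CycDist n A A d → d ≡ 0
cycDist-self c = offset-≡ (proj₁ c ≤-refl) refl refl

cycDist-zero : ∀ {n A B} → A < n → CycDist n A B 0 → A ≡ B
cycDist-zero {n} {A} {B} A<n c with A ≤? B
... | yes A≤B = proj₁ c A≤B
... | no A≰B  = contradiction (subst (A <_) (sym (proj₂ c (≰⇒> A≰B))) (<-≤-trans A<n (m≤m+n n B))) (<-irrefl refl)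

cycDist-bound : ∀ {n A B d} → B < n → CycDist n A B d → d < n
cycDist-bound {n} {A} {B} {d} B<n c with A ≤? B
... | yes A≤B = ≤-<-trans (subst (d ≤_) (proj₁ c A≤B) (m≤m+n d A)) B<n
... | no A≰B  = offset-< (proj₂ c (≰⇒> A≰B)) refl (+-monoʳ-< n (≰⇒> A≰B))

offsets-add : ∀ {P U V dpu duv dpv} k₁ k₂ → dpu + P ≡ U + k₁ → duv + U ≡ V + k₂ →
              dpv + P ≡ V + (k₁ + k₂) → dpu + duv ≡ dpv
offsets-add {P} {U} {V} {dpu} {duv} {dpv} k₁ k₂ e₁ e₂ e₃ = +-cancelʳ-≡ P _ _ (begin
  dpu + duv + P   ≡⟨ xy∙z≈xz∙y dpu duv P ⟩
  dpu + P + duv   ≡⟨ cong (_+ duv) e₁ ⟩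
  U + k₁ + duv    ≡⟨ xy∙z≈xz∙y U k₁ duv ⟩
  U + duv + k₁    ≡⟨ cong (_+ k₁) (trans (+-comm U duv) e₂) ⟩
  V + k₂ + k₁     ≡⟨ +-assoc V k₂ k₁ ⟩
  V + (k₂ + k₁)   ≡⟨ cong (V +_) (+-comm k₂ k₁) ⟩
  V + (k₁ + k₂)   ≡⟨ sym e₃ ⟩
  dpv + P         ∎)
  where open ≡-Reasoning

ahead : ∀ {n A B d} → CycDist n A B d → A ≤ B → d + A ≡ B + 0
ahead {B = B} c A≤B = trans (proj₁ c A≤B) (sym (+-identityʳ B))

wrapped : ∀ {n A B d} → CycDist n A B d → B < A → d + A ≡ B + n
wrapped {n} {B = B} c B<A = trans (proj₂ c B<A) (+-comm n B)

-- Distances add along the cycle, provided the walk P → U is not longer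
-- than P → V (so that U lies on the walk from P to V).
cycDist-add : ∀ {n P U V dpu duv dpv} → CycDist n P U dpu → CycDist n U V duv → CycDist n P V dpv →
              V < n → dpu ≤ dpv → dpu + duv ≡ dpv
cycDist-add {n} {P} {U} {V} c₁ c₂ c₃ V<n le with P ≤? U | U ≤? V | P ≤? V
... | yes pu | yes uv | _      = offsets-add 0 0 (ahead c₁ pu) (ahead c₂ uv) (ahead c₃ (≤-trans pu uv))
... | yes pu | no ¬uv | yes pv = contradiction le (<⇒≱ (offset-< (proj₁ c₃ pv) (proj₁ c₁ pu) (≰⇒> ¬uv)))
... | yes pu | no ¬uv | no ¬pv = offsets-add 0 n (ahead c₁ pu) (wrapped c₂ (≰⇒> ¬uv)) (wrapped c₃ (≰⇒> ¬pv))
... | no ¬pu | yes uv | yes pv = contradiction le (<⇒≱ (offset-< (proj₁ c₃ pv) (proj₂ c₁ (≰⇒> ¬pu)) (<-≤-trans V<n (m≤m+n n U))))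
... | no ¬pu | yes uv | no ¬pv =
  offsets-add n 0 (wrapped c₁ (≰⇒> ¬pu)) (ahead c₂ uv) (trans (wrapped c₃ (≰⇒> ¬pv)) (cong (V +_) (sym (+-identityʳ n))))
... | no ¬pu | no ¬uv | _      =
  contradiction le (<⇒≱ (offset-< (proj₂ c₃ (<-trans (≰⇒> ¬uv) (≰⇒> ¬pu))) (proj₂ c₁ (≰⇒> ¬pu)) (+-monoʳ-< n (≰⇒> ¬uv))))

cycDist-sum : ∀ {n A B dab dba} → A ≢ B → CycDist n A B dab → CycDist n B A dba → dab + dba ≡ n
cycDist-sum {n} {A} {B} {dab} {dba} A≢B c₁ c₂ with <-cmp A B
... | tri≈ _ A≡B _ = contradiction A≡B A≢B
... | tri< A<B _ _ = offset-≡ {A = A} (begin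
  dab + dba + A   ≡⟨ xy∙z≈xz∙y dab dba A ⟩
  dab + A + dba   ≡⟨ cong (_+ dba) (proj₁ c₁ (<⇒≤ A<B)) ⟩
  B + dba         ≡⟨ +-comm B dba ⟩
  dba + B         ≡⟨ proj₂ c₂ A<B ⟩
  n + A           ∎) refl refl
  where open ≡-Reasoning
... | tri> _ _ B<A = offset-≡ {A = B} (begin
  dab + dba + B   ≡⟨ +-assoc dab dba B ⟩
  dab + (dba + B) ≡⟨ cong (dab +_) (proj₁ c₂ (<⇒≤ B<A)) ⟩
  dab + A         ≡⟨ proj₂ c₁ B<A ⟩
  n + B           ∎) refl refl
  where open ≡-Reasoning

-- `CycBetween A X B`: reading the cycle starting at A, we meet X strictly
-- before B; i.e. A, X, B are distinct and in one of the three cyclic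
-- rotations of increasing order.
CycBetween : ℕ → ℕ → ℕ → Set
CycBetween A X B = (A < X × X < B) ⊎ (X < B × B < A) ⊎ (B < A × A < X)

cycBetween-from-dist : ∀ {n A X B dax dab} → B < n → CycDist n A X dax → CycDist n A B dab →
                       0 < dax → dax < dab → CycBetween A X B
cycBetween-from-dist {n} {A} {X} {B} Bn c₁ c₂ p q with <-cmp A X | <-cmp A B
... | tri≈ _ refl _ | _ = contradiction (cycDist-self c₁) (>⇒≢ p)
... | _ | tri≈ _ refl _ = contradiction (subst (_ <_) (cycDist-self c₂) q) n≮0
... | tri< ax _ _ | tri< ab _ _ = inj₁ (ax , subst₂ _<_ (proj₁ c₁ (<⇒≤ ax)) (proj₁ c₂ (<⇒≤ ab)) (+-monoˡ-< A q))
... | tri< ax _ _ | tri> _ _ ba = inj₂ (inj₂ (ba , ax))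
... | tri> _ _ xa | tri< ab _ _ = contradiction q (<-asym (offset-< (proj₁ c₂ (<⇒≤ ab)) (proj₂ c₁ xa) (<-≤-trans Bn (m≤m+n n X))))
... | tri> _ _ xa | tri> _ _ ba = inj₂ (inj₁ (+-cancelˡ-< n X B (subst₂ _<_ (proj₂ c₁ xa) (proj₂ c₂ ba) (+-monoˡ-< A q)) , ba))

dist-from-cycBetween : ∀ {n A X B dax dab} → A < n → X < n → CycDist n A X dax → CycDist n A B dab →
                       CycBetween A X B → (0 < dax) × (dax < dab)
dist-from-cycBetween {n} {A} {X} {B} An Xn c₁ c₂ (inj₁ (ax , xb)) =
  offset-< {A = A} refl (proj₁ c₁ (<⇒≤ ax)) ax , offset-< (proj₁ c₁ (<⇒≤ ax)) (proj₁ c₂ (<⇒≤ (<-trans ax xb))) xb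
dist-from-cycBetween {n} {A} {X} {B} An Xn c₁ c₂ (inj₂ (inj₁ (xb , ba))) =
  offset-< {A = A} refl (proj₂ c₁ (<-trans xb ba)) (<-≤-trans An (m≤m+n n X)) , offset-< (proj₂ c₁ (<-trans xb ba)) (proj₂ c₂ ba) (+-monoʳ-< n xb)
dist-from-cycBetween {n} {A} {X} {B} An Xn c₁ c₂ (inj₂ (inj₂ (ba , ax))) =
  offset-< {A = A} refl (proj₁ c₁ (<⇒≤ ax)) ax , offset-< (proj₁ c₁ (<⇒≤ ax)) (proj₂ c₂ ba) (<-≤-trans Xn (m≤m+n n B))

cycBetween-rotate : ∀ {A X B} → CycBetween A X B → CycBetween X B A
cycBetween-rotate (inj₁ p) = inj₂ (inj₂ p)
cycBetween-rotate (inj₂ (inj₁ p)) = inj₁ p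
cycBetween-rotate (inj₂ (inj₂ p)) = inj₂ (inj₁ p)

cycBetween-asym : ∀ {A X B} → CycBetween A X B → ¬ CycBetween B X A
cycBetween-asym (inj₁ (ax , xb)) (inj₁ (bx , xa)) = <-asym ax xa
cycBetween-asym (inj₁ (ax , xb)) (inj₂ (inj₁ (xa , ab))) = <-asym ax xa
cycBetween-asym (inj₁ (ax , xb)) (inj₂ (inj₂ (ab , bx))) = <-asym xb bx
cycBetween-asym (inj₂ (inj₁ (xb , ba))) (inj₁ (bx , xa)) = <-asym xb bx
cycBetween-asym (inj₂ (inj₁ (xb , ba))) (inj₂ (inj₁ (xa , ab))) = <-asym ab ba
cycBetween-asym (inj₂ (inj₁ (xb , ba))) (inj₂ (inj₂ (ab , bx))) = <-asym xb bx
cycBetween-asym (inj₂ (inj₂ (ba , ax))) (inj₁ (bx , xa)) = <-asym ax xa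
cycBetween-asym (inj₂ (inj₂ (ba , ax))) (inj₂ (inj₁ (xa , ab))) = <-asym ab ba
cycBetween-asym (inj₂ (inj₂ (ba , ax))) (inj₂ (inj₂ (ab , bx))) = <-asym ab ba

cycBetween-total : ∀ {A X B} → A ≢ X → X ≢ B → A ≢ B → CycBetween A X B ⊎ CycBetween B X A
cycBetween-total {A} {X} {B} A≢X X≢B A≢B with <-cmp A X | <-cmp X B | <-cmp A B
... | tri≈ _ e _ | _ | _ = contradiction e A≢X
... | _ | tri≈ _ e _ | _ = contradiction e X≢B
... | _ | _ | tri≈ _ e _ = contradiction e A≢B
... | tri< p _ _ | tri< q _ _ | _          = inj₁ (inj₁ (p , q))
... | tri< p _ _ | tri> _ _ q | tri< r _ _ = inj₂ (inj₂ (inj₂ (r , q)))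
... | tri< p _ _ | tri> _ _ q | tri> _ _ r = inj₁ (inj₂ (inj₂ (r , p)))
... | tri> _ _ p | tri< q _ _ | tri< r _ _ = inj₂ (inj₂ (inj₁ (p , r)))
... | tri> _ _ p | tri< q _ _ | tri> _ _ r = inj₁ (inj₂ (inj₁ (q , r)))
... | tri> _ _ p | tri> _ _ q | _          = inj₂ (inj₁ (q , p))

-- `Beside X Y V`: the point V does not separate X from Y on the line.
Beside : ℕ → ℕ → ℕ → Set
Beside X Y V = (V < X × V < Y) ⊎ (X < V × Y < V)

cycBetween-move : ∀ {X Y C E} → Beside X Y C → Beside X Y E → CycBetween C X E → CycBetween C Y E
cycBetween-move {X} {Y} {C} {E} bc be = move
  where
  below : ∀ {V} → Beside X Y V → V < X → V < Y
  below (inj₁ (_ , vy)) _ = vy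
  below (inj₂ (xv , _)) vx = contradiction vx (<-asym xv)
  above : ∀ {V} → Beside X Y V → X < V → Y < V
  above (inj₂ (_ , yv)) _ = yv
  above (inj₁ (vx , _)) xv = contradiction xv (<-asym vx)
  move : CycBetween C X E → CycBetween C Y E
  move (inj₁ (cx , xe)) = inj₁ (below bc cx , above be xe)
  move (inj₂ (inj₁ (xe , ec))) = inj₂ (inj₁ (above be xe , ec))
  move (inj₂ (inj₂ (ec , cx))) = inj₂ (inj₂ (ec , below bc cx))

module CyclicOrder {n : ℕ} where

  dist-cycDist : (a b : Fin n) → CycDist n (toℕ a) (toℕ b) (dist n a b)
  dist-cycDist a b = forward , backward
    where
    A = toℕ a
    B = toℕ b
    forward : A ≤ B → dist n a b + A ≡ B
    forward A≤B with A ≤ᵇ B | ≤⇒≤ᵇ A≤B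
    ... | true | _ = m∸n+n≡m A≤B
    backward : B < A → dist n a b + A ≡ n + B
    backward B<A with A ≤ᵇ B in eq
    ... | true  = contradiction (≤ᵇ⇒≤ A B (subst T (sym eq) _)) (<⇒≱ B<A)
    ... | false = begin
      n ∸ A + B + A   ≡⟨ xy∙z≈xz∙y (n ∸ A) B A ⟩
      n ∸ A + A + B   ≡⟨ cong (_+ B) (m∸n+n≡m (<⇒≤ (toℕ<n a))) ⟩
      n + B           ∎
      where open ≡-Reasoning

  dist-add : ∀ p u v → dist n p u ≤ dist n p v → dist n p u + dist n u v ≡ dist n p v
  dist-add p u v = cycDist-add (dist-cycDist p u) (dist-cycDist u v) (dist-cycDist p v) (toℕ<n v)

  dist-sum : ∀ {a b} → a ≢ b → dist n a b + dist n b a ≡ n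
  dist-sum {a} {b} a≢b = cycDist-sum (λ e → a≢b (toℕ-injective e)) (dist-cycDist a b) (dist-cycDist b a)

  dist-bound : ∀ a b → dist n a b < n
  dist-bound a b = cycDist-bound (toℕ<n b) (dist-cycDist a b)

  dist-self : ∀ a → dist n a a ≡ 0
  dist-self a = cycDist-self (dist-cycDist a a)

  dist-zero : ∀ {a b} → dist n a b ≡ 0 → a ≡ b
  dist-zero {a} {b} e = toℕ-injective (cycDist-zero (toℕ<n a) (subst (CycDist n (toℕ a) (toℕ b)) e (dist-cycDist a b)))

  dist-injective : ∀ p {u v} → dist n p u ≡ dist n p v → u ≡ v
  dist-injective p {u} {v} e = dist-zero (+-cancelˡ-≡ (dist n p u) (dist n u v) 0
    (trans (dist-add p u v (≤-reflexive e)) (trans (sym e) (sym (+-identityʳ _)))))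

  -- Measuring from any base vertex p is a rotation of the cycle: the
  -- distance from a to x is the cyclic distance between their p-coordinates.
  dist-rebase : ∀ p a x → CycDist n (dist n p a) (dist n p x) (dist n a x)
  dist-rebase p a x = ahead′ , wrapped′
    where
    ahead′ : dist n p a ≤ dist n p x → dist n a x + dist n p a ≡ dist n p x
    ahead′ le = trans (+-comm (dist n a x) (dist n p a)) (dist-add p a x le)
    wrapped′ : dist n p x < dist n p a → dist n a x + dist n p a ≡ n + dist n p x
    wrapped′ lt = begin
      dist n a x + dist n p a                ≡⟨ cong (dist n a x +_) (sym (dist-add p x a (<⇒≤ lt))) ⟩
      dist n a x + (dist n p x + dist n x a) ≡⟨ cong (dist n a x +_) (+-comm (dist n p x) (dist n x a)) ⟩
      dist n a x + (dist n x a + dist n p x) ≡⟨ sym (+-assoc (dist n a x) (dist n x a) (dist n p x)) ⟩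
      dist n a x + dist n x a + dist n p x   ≡⟨ cong (_+ dist n p x) (dist-sum (λ e → <-irrefl (cong (dist n p) (sym e)) lt)) ⟩
      n + dist n p x                         ∎
      where open ≡-Reasoning

  btw⇒cycBetween : ∀ p {a x b} → Btw< a x b → CycBetween (dist n p a) (dist n p x) (dist n p b)
  btw⇒cycBetween p {a} {x} {b} (pos , lt) =
    cycBetween-from-dist (dist-bound p b) (dist-rebase p a x) (dist-rebase p a b) pos lt

  cycBetween⇒btw : ∀ p {a x b} → CycBetween (dist n p a) (dist n p x) (dist n p b) → Btw< a x b
  cycBetween⇒btw p {a} {x} {b} =
    dist-from-cycBetween (dist-bound p a) (dist-bound p x) (dist-rebase p a x) (dist-rebase p a b)

  btw-rotate : ∀ {a x b} → Btw< a x b → Btw< x b a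
  btw-rotate {a} {x} {b} h = cycBetween⇒btw a {x} {b} {a} (cycBetween-rotate (btw⇒cycBetween a {a} {x} {b} h))

  btw-asym : ∀ {a x b} → Btw< a x b → ¬ Btw< b x a
  btw-asym {a} {x} {b} h h′ = cycBetween-asym (btw⇒cycBetween a {a} {x} {b} h) (btw⇒cycBetween a {b} {x} {a} h′)

  btw-total : ∀ {a x b} → a ≢ x → x ≢ b → a ≢ b → Btw< a x b ⊎ Btw< b x a
  btw-total {a} {x} {b} a≢x x≢b a≢b with cycBetween-total (≢-dist a≢x) (≢-dist x≢b) (≢-dist a≢b)
    where
    ≢-dist : ∀ {u v} → u ≢ v → dist n a u ≢ dist n a v
    ≢-dist u≢v e = u≢v (dist-injective a e)
  ... | inj₁ l = inj₁ (cycBetween⇒btw a {a} {x} {b} l)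
  ... | inj₂ l = inj₂ (cycBetween⇒btw a {b} {x} {a} l)

  btw-shrink : ∀ {a b c e : Fin n} → Btw< a b c → Btw< a c e → Btw< a b e
  btw-shrink (pos , lt) (_ , lt′) = pos , <-trans lt lt′

  btw-start≢ : ∀ {a x b} → Btw< a x b → a ≢ x
  btw-start≢ {a} {x} {b} (pos , _) refl = <-irrefl (sym (dist-self a)) pos

  btw-≢end : ∀ {a x b : Fin n} → Btw< a x b → x ≢ b
  btw-≢end (_ , lt) refl = <-irrefl refl lt

  btw≤⇒btw< : ∀ {a x b} → Btw≤ a x b → x ≢ a → x ≢ b → Btw< a x b
  btw≤⇒btw< {a} {x} {b} le x≢a x≢b =
    n≢0⇒n>0 (λ e → x≢a (sym (dist-zero e))) , ≤∧≢⇒< le (λ e → x≢b (dist-injective a e))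

  btw≤-start : ∀ {a b} → Btw≤ a a b
  btw≤-start {a} {b} = subst (_≤ dist n a b) (sym (dist-self a)) z≤n

  btw≤-end : ∀ {a b : Fin n} → Btw≤ a b b
  btw≤-end = ≤-refl

  -- In the coordinates of p, a vertex v off the open arc (p, q) is either
  -- p itself or lies beyond q; so if v ≠ y it separates no two points x ∈ (p, q)
  -- and y ∈ (p, q].
  off-arc-beside : ∀ {p q x y v : Fin n} → Btw< p x q → (Btw< p y q ⊎ y ≡ q) → ¬ Btw< p v q → v ≢ y →
                   Beside (dist n p x) (dist n p y) (dist n p v)
  off-arc-beside {p} {q} {x} {y} {v} hx hy v∉ v≢y with dist n p v in eq
  ... | zero  = inj₁ (proj₁ hx , y-pos)
    where
    y-pos : 0 < dist n p y
    y-pos = [ proj₁ , (λ { refl → <-trans (proj₁ hx) (proj₂ hx) }) ]′ hy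
  ... | suc k = inj₂ (<-≤-trans (proj₂ hx) q≤v , ≤∧≢⇒< (≤-trans y≤q q≤v) (λ e → v≢y (dist-injective p (trans eq (sym e)))))
    where
    y≤q : dist n p y ≤ dist n p q
    y≤q = [ (λ h → <⇒≤ (proj₂ h)) , (λ { refl → ≤-refl }) ]′ hy
    q≤v : dist n p q ≤ suc k
    q≤v = ≮⇒≥ (λ lt → v∉ (s≤s z≤n , lt))

  SidesAgree : Fin n → Fin n → Fin n × Fin n → Set
  SidesAgree x y (c , e) = SameSide c e x y

  ClearOf : Fin n → Fin n → Fin n → Fin n × Fin n → Set
  ClearOf p q y (c , e) = ¬ Btw< p c q × ¬ Btw< p e q × c ≢ y × e ≢ y × c ≢ e

  arc-sameSide : ∀ {p q x y : Fin n} {t} → Btw< p x q → (Btw< p y q ⊎ y ≡ q) → ClearOf p q y t → SidesAgree x y t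
  arc-sameSide {p} {q} {x} {y} {c , e} hx hy (c∉ , e∉ , c≢y , e≢y , c≢e) = side (btw-total {c} {x} {e} c≢x x≢e c≢e)
    where
    c≢x : c ≢ x
    c≢x refl = c∉ hx
    x≢e : x ≢ e
    x≢e refl = e∉ hx
    bc = off-arc-beside {p} {q} {x} {y} {c} hx hy c∉ c≢y
    be = off-arc-beside {p} {q} {x} {y} {e} hx hy e∉ e≢y
    side : Btw< c x e ⊎ Btw< e x c → SameSide c e x y
    side (inj₁ h) = inj₁ (h , cycBetween⇒btw p {c} {y} {e} (cycBetween-move bc be (btw⇒cycBetween p {c} {x} {e} h)))
    side (inj₂ h) = inj₂ (h , cycBetween⇒btw p {e} {y} {c} (cycBetween-move be bc (btw⇒cycBetween p {e} {x} {c} h)))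

  sameSide-sym : ∀ {a b x y : Fin n} → SameSide a b x y → SameSide a b y x
  sameSide-sym (inj₁ (p , q)) = inj₁ (q , p)
  sameSide-sym (inj₂ (p , q)) = inj₂ (q , p)

  sameSide-trans : ∀ {a b x y z : Fin n} → SameSide a b x y → SameSide a b y z → SameSide a b x z
  sameSide-trans (inj₁ (p , _)) (inj₁ (_ , s)) = inj₁ (p , s)
  sameSide-trans {a} {b} {x} {y} (inj₁ (_ , q)) (inj₂ (r , _)) = contradiction r (btw-asym {a} {y} {b} q)
  sameSide-trans {a} {b} {x} {y} (inj₂ (_ , q)) (inj₁ (r , _)) = contradiction r (btw-asym {b} {y} {a} q)
  sameSide-trans (inj₂ (p , _)) (inj₂ (_ , s)) = inj₂ (p , s)

  sameSide-≢ : ∀ {a b x y : Fin n} → SameSide a b x y → a ≢ y × b ≢ y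
  sameSide-≢ {a} {b} {x} {y} (inj₁ (_ , h)) = btw-start≢ {a} {y} {b} h , (λ e → btw-≢end {a} {y} {b} h (sym e))
  sameSide-≢ {a} {b} {x} {y} (inj₂ (_ , h)) = (λ e → btw-≢end {b} {y} {a} h (sym e)) , btw-start≢ {b} {y} {a} h

  cross-transport : ∀ {a b x y β : Fin n} → SameSide a b x y → Cross (a , b) (x , β) → Cross (a , b) (y , β)
  cross-transport (inj₁ (_ , q)) (inj₁ (_ , s)) = inj₁ (q , s)
  cross-transport {a} {b} {x} (inj₁ (p , _)) (inj₂ (_ , s)) = contradiction s (btw-asym {a} {x} {b} p)
  cross-transport {a} {b} {x} (inj₂ (p , _)) (inj₁ (r , _)) = contradiction p (btw-asym {a} {x} {b} r)
  cross-transport (inj₂ (_ , q)) (inj₂ (r , _)) = inj₂ (r , q)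

all-evens : ∀ {A : Set} {P : A → Set} (xs : List A) → All P xs → All P (evens xs)
all-evens []          _              = []
all-evens (_ ∷ [])    _              = []
all-evens (_ ∷ _ ∷ r) (_ ∷ py ∷ pr) = py ∷ all-evens r pr

-- A map which replaces a prefix shared by all source lists by a fixed
-- first entry forgets nothing, hence is injective on the sources.
replace-prefix-injective : ∀ {A : Set} (pre : List A) k (y : A) {Src : List A → Set} →
  (∀ π → Src π → π ≡ pre ++ drop k π) →
  ∀ π π′ → Src π → Src π′ → y ∷ drop k π ≡ y ∷ drop k π′ → π ≡ π′
replace-prefix-injective pre k y shape π π′ s s′ e =
  trans (shape π s) (trans (cong (pre ++_) (∷-injectiveʳ e)) (sym (shape π′ s′)))

module _ {n : ℕ} where
  open CyclicOrder {n}

  sameDiag-swap : ∀ {a b : Fin n} {s} → SameDiag (a , b) s → SameDiag (b , a) s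
  sameDiag-swap (inj₁ (p , q)) = inj₂ (q , p)
  sameDiag-swap (inj₂ (p , q)) = inj₁ (q , p)

  cross-swap : ∀ {a b : Fin n} {t} → Cross (a , b) t → Cross (b , a) t
  cross-swap (inj₁ (p , q)) = inj₂ (q , p)
  cross-swap (inj₂ (p , q)) = inj₁ (q , p)

  Proper : Fin n × Fin n → Set
  Proper (c , e) = c ≢ e

  cross-endpoints-≢ : ∀ {a b x β : Fin n} → Cross (a , b) (x , β) → a ≢ x × b ≢ x
  cross-endpoints-≢ {a} {b} {x} (inj₁ (h , _)) = btw-start≢ {a} {x} {b} h , (λ e → btw-≢end {a} {x} {b} h (sym e))
  cross-endpoints-≢ {a} {b} {x} (inj₂ (_ , h)) = (λ e → btw-≢end {b} {x} {a} h (sym e)) , btw-start≢ {b} {x} {a} h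

  steps-avoid : ∀ {a b : Fin n} (L : List (Fin n)) → All (_≢ a) L → All (λ s → ¬ SameDiag (a , b) s) (steps L)
  steps-avoid []          _              = []
  steps-avoid (_ ∷ [])    _              = []
  steps-avoid (x ∷ y ∷ r) (x≢a ∷ y≢a ∷ r≢a) = not-ab ∷ steps-avoid (y ∷ r) (y≢a ∷ r≢a)
    where
    not-ab : ¬ SameDiag _ (x , y)
    not-ab (inj₁ (e , _)) = x≢a (sym e)
    not-ab (inj₂ (e , _)) = y≢a (sym e)

  -- Every vertex of a walk after the first is an endpoint of an even step,
  -- or the last vertex.
  vertices-after-first : ∀ {Q : Fin n → Set} {β : Fin n} (y : Fin n) (L : List (Fin n)) →
    last (y ∷ L) ≡ just β → Q β → All (λ s → Q (proj₁ s) × Q (proj₂ s)) (evens (steps (y ∷ L))) → All Q L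
  vertices-after-first y []          _    _   _                    = []
  vertices-after-first y (a ∷ [])    refl qβ _                    = qβ ∷ []
  vertices-after-first y (a ∷ b ∷ r) eq   qβ ((qa , qb) ∷ evens) = qa ∷ qb ∷ vertices-after-first b r eq qβ evens

  before-off-arc : ∀ {p q x : Fin n} {t} → Btw< p x q → Before x (p , q) t → ¬ Btw< p (proj₁ t) q × ¬ Btw< p (proj₂ t) q
  before-off-arc hx (_ , c∉ , e∉) = (λ h → c∉ (inj₁ (hx , h))) , (λ h → e∉ (inj₁ (hx , h)))

  before-avoids : ∀ {a b x y : Fin n} {t} → SameSide a b x y → Before x (a , b) t → proj₁ t ≢ y × proj₂ t ≢ y
  before-avoids same (_ , c∉ , e∉) = (λ { refl → c∉ same }) , (λ { refl → e∉ same })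

  before-transport : ∀ {a b x y : Fin n} {t} → SameSide a b x y → Before x (a , b) t → Before y (a , b) t
  before-transport {a} {b} {x} {y} same (t≠s , c∉ , e∉) =
    t≠s , (λ h → c∉ (sameSide-trans {a} {b} {x} {y} same h)) , (λ h → e∉ (sameSide-trans {a} {b} {x} {y} same h))

  EvenStepsOK : (Diag n → Set) → Fin n → Fin n → List (Fin n × Fin n) → Set
  EvenStepsOK D x β E = All (λ s → InD D s × Cross s (x , β)) E × AllPairs (Before x) E

  evenSteps-transport : ∀ {D : Diag n → Set} {x y β : Fin n} {E} → All (SidesAgree x y) E →
                        EvenStepsOK D x β E → EvenStepsOK D y β E
  evenSteps-transport [] ([] , []) = [] , []
  evenSteps-transport {x = x} {y} {β} {(a , b) ∷ _} (same ∷ sames) ((inD , cross) ∷ crosses , before ∷ befores) =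
    let (crosses′ , befores′) = evenSteps-transport sames (crosses , befores)
    in  (inD , cross-transport {a} {b} {x} {y} {β} same cross) ∷ crosses′
      , All.map (before-transport {a} {b} {x} {y} same) before ∷ befores′

  evens-steps-first : ∀ (x y v : Fin n) r → evens (steps (x ∷ v ∷ r)) ≡ evens (steps (y ∷ v ∷ r))
  evens-steps-first x y v []      = refl
  evens-steps-first x y v (_ ∷ _) = refl

  reroot : ∀ {D : Diag n → Set} {x y v β : Fin n} (r : List (Fin n)) →
    IsTPath D x β (x ∷ v ∷ r) → y ≢ β → All (_≢ y) (v ∷ r) → (∀ e → D e → ¬ Cross (y , v) (endpts e)) →
    All (SidesAgree x y) (evens (steps (x ∷ v ∷ r))) → IsTPath D y β (y ∷ v ∷ r)
  reroot {D} {x} {y} {v} {β} r (_ , _ , lt , nz , ds , nx , ev , bf) y≢β avoid noCross sides =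
    y≢β , refl , lt , (λ e → All.head avoid (sym e)) ∷ All.tail nz ,
    steps-avoid (v ∷ r) avoid ∷ AllPairs.tail ds , noCross ∷ All.tail nx ,
    subst (EvenStepsOK D y β) (evens-steps-first x y v r) (evenSteps-transport sides (ev , bf))

-- The multiplication of a semifield is an abelian group, so the library's
-- group identities apply to K; the weights need two fraction identities.
module SemifieldAlgebra {c : Level} (K : Semifield c) where
  open Semifield K
  open ≡-Reasoning

  *-abelianGroup : AbelianGroup c c
  *-abelianGroup = record
    { Carrier        = Carrier
    ; _≈_            = _≡_
    ; _∙_            = _*_
    ; ε              = 1#
    ; _⁻¹            = _⁻¹
    ; isAbelianGroup = record
      { isGroup = record
        { isMonoid = record
          { isSemigroup = record
            { isMagma = record { isEquivalence = isEquivalence ; ∙-cong = cong₂ _*_ }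
            ; assoc   = *-assoc }
          ; identity = *-identityˡ , (λ x → trans (*-comm x 1#) (*-identityˡ x)) }
        ; inverse = *-inverseˡ , (λ x → trans (*-comm x (x ⁻¹)) (*-inverseˡ x))
        ; ⁻¹-cong = cong _⁻¹ }
      ; comm = *-comm } }

  open AbelianGroup *-abelianGroup using (commutativeSemigroup)
  open AbelianGroupProperties *-abelianGroup using (⁻¹-∙-comm)
  open GroupProperties (AbelianGroup.group *-abelianGroup) using (\\-leftDividesʳ)
  open CommSemigroupProperties commutativeSemigroup using (interchange)

  /-*-/ : ∀ a b x y → (a / b) * (x / y) ≡ (a * x) / (b * y)
  /-*-/ a b x y = begin
    (a * b ⁻¹) * (x * y ⁻¹)  ≡⟨ interchange a (b ⁻¹) x (y ⁻¹) ⟩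
    (a * x) * (b ⁻¹ * y ⁻¹)  ≡⟨ cong ((a * x) *_) (⁻¹-∙-comm b y) ⟩
    (a * x) * (b * y) ⁻¹     ∎

  /-cancel : ∀ a h x y → (a / h) * ((h * x) / y) ≡ (a * x) / y
  /-cancel a h x y = begin
    (a * h ⁻¹) * ((h * x) * y ⁻¹)  ≡⟨ sym (*-assoc (a * h ⁻¹) (h * x) (y ⁻¹)) ⟩
    (a * h ⁻¹) * (h * x) * y ⁻¹    ≡⟨ cong (_* y ⁻¹) (*-assoc a (h ⁻¹) (h * x)) ⟩
    a * (h ⁻¹ * (h * x)) * y ⁻¹    ≡⟨ cong (λ z → a * z * y ⁻¹) (\\-leftDividesʳ h x) ⟩
    (a * x) * y ⁻¹                 ∎

module _ {c : Level} (K : Semifield c) {n : ℕ} (f : Diag n → Semifield.Carrier K) where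
  open Semifield K
  open SemifieldAlgebra K

  weight-reroot : ∀ a h v r → (fp K f a v / fp K f h v) * weight K f (h ∷ v ∷ r) ≡ weight K f (a ∷ v ∷ r)
  weight-reroot a h v r = /-cancel (fp K f a v) (fp K f h v) _ _

  weight-prepend₂ : ∀ a z h r → (fp K f a z / fp K f z h) * weight K f (h ∷ r) ≡ weight K f (a ∷ z ∷ h ∷ r)
  weight-prepend₂ a z h r = /-*-/ (fp K f a z) (fp K f z h) _ _

module Configuration
  {n : ℕ} (ζ η : Fin n) (ζ≢η : ζ ≢ η)
  (D D₂ : Diag n → Set)
  (dD : IsDissection AllV D)
  (dD₂ : IsDissection (λ v → Btw≤ η v ζ) D₂)
  (toD : ∀ e → D e → SameDiag (endpts e) (ζ , η) ⊎ D₂ e)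
  (fromD : ∀ e → SameDiag (endpts e) (ζ , η) ⊎ D₂ e → D e)
  (α β : Fin n) (hα : Btw< ζ α η) (hβ : Btw< η β ζ) where

  open CyclicOrder {n}

  P₂ : Fin n → Set
  P₂ v = Btw≤ η v ζ

  α≢ζ : α ≢ ζ
  α≢ζ e = btw-start≢ {ζ} {α} {η} hα (sym e)

  α≢β : α ≢ β
  α≢β refl = btw-asym {ζ} {α} {η} hα hβ

  α≢η : α ≢ η
  α≢η = btw-≢end {ζ} {α} {η} hα

  η≢β : η ≢ β
  η≢β = btw-start≢ {η} {β} {ζ} hβ

  β≢ζ : β ≢ ζ
  β≢ζ = btw-≢end {η} {β} {ζ} hβ

  P₂-avoids-U₁ : ∀ {v} → P₂ v → ¬ Btw< ζ v η
  P₂-avoids-U₁ {v} v∈P₂ h =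
    btw-asym {ζ} {v} {η} h (btw≤⇒btw< {η} {v} {ζ} v∈P₂ (btw-≢end {ζ} {v} {η} h) (btw-start≢ {ζ} {v} {η} h ∘ sym))

  P₂-avoids-α : ∀ {v} → P₂ v → v ≢ α
  P₂-avoids-α v∈P₂ refl = P₂-avoids-U₁ v∈P₂ hα

  D-in-P₂ : ∀ e → D e → P₂ (Diag.lo e) × P₂ (Diag.hi e)
  D-in-P₂ e De with toD e De
  ... | inj₁ (inj₁ (refl , refl)) = btw≤-end {η} {ζ} , btw≤-start {η} {ζ}
  ... | inj₁ (inj₂ (refl , refl)) = btw≤-start {η} {ζ} , btw≤-end {η} {ζ}
  ... | inj₂ D₂e = proj₁ (proj₁ dD₂ e D₂e) , proj₁ (proj₂ (proj₁ dD₂ e D₂e))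

  InD-in-P₂ : ∀ {s} → InD D s → P₂ (proj₁ s) × P₂ (proj₂ s)
  InD-in-P₂ (e , De , inj₁ (refl , refl)) = D-in-P₂ e De
  InD-in-P₂ (e , De , inj₂ (refl , refl)) = proj₂ (D-in-P₂ e De) , proj₁ (D-in-P₂ e De)

  ζη∈D : InD D (ζ , η)
  ζη∈D with FinP.<-cmp ζ η
  ... | tri< ζ<η _ _ = diag ζ η ζ<η , fromD _ (inj₁ (inj₁ (refl , refl))) , inj₁ (refl , refl)
  ... | tri≈ _ ζ≡η _ = contradiction ζ≡η ζ≢η
  ... | tri> _ _ η<ζ = diag η ζ η<ζ , fromD _ (inj₁ (inj₂ (refl , refl))) , inj₂ (refl , refl)

  ζη-noncrossing : ∀ e → D e → ¬ Cross (ζ , η) (endpts e)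
  ζη-noncrossing e De x with ζη∈D
  ... | e₀ , De₀ , inj₁ (refl , refl) = proj₂ dD e₀ e De₀ De x
  ... | e₀ , De₀ , inj₂ (refl , refl) = proj₂ dD e₀ e De₀ De (cross-swap {a = ζ} {b = η} x)

  ηζ-noncrossing : ∀ e → D e → ¬ Cross (η , ζ) (endpts e)
  ηζ-noncrossing e De = ζη-noncrossing e De ∘ cross-swap {a = η} {b = ζ}

  -- a crossing would need an endpoint strictly between ζ and α, inside U₁
  αζ-noncrossing : ∀ e → D e → ¬ Cross (α , ζ) (endpts e)
  αζ-noncrossing e De (inj₁ (_ , h)) = P₂-avoids-U₁ (proj₂ (D-in-P₂ e De)) (btw-shrink {ζ} {Diag.hi e} {α} {η} h hα)
  αζ-noncrossing e De (inj₂ (_ , h)) = P₂-avoids-U₁ (proj₁ (D-in-P₂ e De)) (btw-shrink {ζ} {Diag.lo e} {α} {η} h hα)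

  arc-to-P₂ : ∀ {r} → P₂ r → r ≢ ζ → r ≢ η → Btw< ζ α r × Btw< ζ η r
  arc-to-P₂ {r} r∈P₂ r≢ζ r≢η = btw-shrink {ζ} {α} {η} {r} hα ζηr , ζηr
    where
    ζηr : Btw< ζ η r
    ζηr = btw-rotate {r} {ζ} {η} (btw-rotate {η} {r} {ζ} (btw≤⇒btw< {η} {r} {ζ} r∈P₂ r≢η r≢ζ))

  sides-agree-R : ∀ {v r} {E : List (Fin n × Fin n)} → Btw< ζ v r → Btw< ζ α r → Btw< ζ η r →
                  All (Before v (ζ , r)) E → All Proper E → All (SidesAgree α η) ((ζ , r) ∷ E)
  sides-agree-R {v} {r} hv αζr ηζr afters propers =
    inj₁ (αζr , ηζr) ∷ All.zipWith (arc-sameSide {ζ} {r} {α} {η} αζr (inj₁ ηζr) ∘ clear) (afters , propers)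
    where
    clear : ∀ {t} → Before v (ζ , r) t × Proper t → ClearOf ζ r η t
    clear (after , proper) with before-off-arc {p = ζ} {q = r} {x = v} hv after
    ... | c∉ , e∉ = c∉ , e∉ , (λ { refl → c∉ ηζr }) , (λ { refl → e∉ ηζr }) , proper

  sides-agree-S : ∀ {t} → ClearOf ζ η η t → SidesAgree α η t
  sides-agree-S = arc-sameSide {ζ} {η} {α} {η} hα (inj₂ refl)

  SrcR TgtR SrcS TgtS : List (Fin n) → Set
  SrcR π = IsTPath D α β π × at π 1 ≡ just ζ × at π 2 ≢ just η
  TgtR ρ = IsTPath D η β ρ × at ρ 1 ≡ just ζ
  SrcS π = IsTPath D α β π × at π 1 ≡ just ζ × at π 2 ≡ just η
  TgtS σ = IsTPath D η β σ × at σ 1 ≢ just ζ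

  -- A T-path starting at v ∈ {α, η} with second vertex ζ has a third vertex
  -- r ∈ P₂ \ {ζ}, since {ζ, r} is its first even step.
  third-vertex : ∀ {v r r′} → IsTPath D v β (v ∷ ζ ∷ r ∷ r′) → P₂ r × r ≢ ζ
  third-vertex (_ , _ , _ , nz , _ , _ , ev , _) = proj₂ (InD-in-P₂ (proj₁ (All.head ev))) , All.head (All.tail nz) ∘ sym

  -- (i) R turns α ζ π₃ … (π₃ ≠ η) into η ζ π₃ …: the new first step {η, ζ}
  -- lies in D, and α, η lie on the same side of every even step.
  R-maps : ∀ π → SrcR π → TgtR (Rmap η π)
  R-maps []          ((_ , () , _) , _)
  R-maps (_ ∷ [])    (_ , () , _)
  R-maps (_ ∷ _ ∷ []) ((_ , _ , lt , _) , refl , _) = contradiction (just-injective lt) (β≢ζ ∘ sym)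
  R-maps (_ ∷ _ ∷ r ∷ r′) (path@(_ , refl , lt , nz , _ , _ , _ , bf) , refl , π₃≢η) =
    reroot (r ∷ r′) path η≢β avoids-η ηζ-noncrossing sides , refl
    where
    r∈P₂ : P₂ r × r ≢ ζ
    r∈P₂ = third-vertex path
    arcs : Btw< ζ α r × Btw< ζ η r
    arcs = arc-to-P₂ (proj₁ r∈P₂) (proj₂ r∈P₂) (π₃≢η ∘ cong just)
    sides : All (SidesAgree α η) (evens (steps (α ∷ ζ ∷ r ∷ r′)))
    sides = sides-agree-R (proj₁ arcs) (proj₁ arcs) (proj₂ arcs) (AllPairs.head bf) (All.tail (all-evens _ nz))
    avoids-η : All (_≢ η) (ζ ∷ r ∷ r′)
    avoids-η = vertices-after-first α (ζ ∷ r ∷ r′) lt (η≢β ∘ sym) (All.map (λ {s} → sameSide-≢ {proj₁ s} {proj₂ s} {α} {η}) sides)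

  -- every T-path η ζ r … arises from α ζ r …, since {α, ζ} crosses nothing
  R-onto : ∀ ρ → TgtR ρ → Σ (List (Fin n)) λ π → SrcR π × Rmap η π ≡ ρ
  R-onto []          ((_ , () , _) , _)
  R-onto (_ ∷ [])    (_ , ())
  R-onto (_ ∷ _ ∷ []) ((_ , _ , lt , _) , refl) = contradiction (just-injective lt) (β≢ζ ∘ sym)
  R-onto (_ ∷ _ ∷ r ∷ r′) (path@(_ , refl , lt , nz , ds , _ , ev , bf) , refl) =
    (α ∷ ζ ∷ r ∷ r′) , (reroot (r ∷ r′) path α≢β avoids-α αζ-noncrossing sides , refl , r≢η ∘ just-injective) , refl
    where
    r∈P₂ : P₂ r × r ≢ ζ
    r∈P₂ = third-vertex path
    r≢η : r ≢ η
    r≢η e = All.head (AllPairs.head ds) (inj₂ (sym e , refl))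
    arcs : Btw< ζ α r × Btw< ζ η r
    arcs = arc-to-P₂ (proj₁ r∈P₂) (proj₂ r∈P₂) r≢η
    sides : All (SidesAgree η α) (evens (steps (η ∷ ζ ∷ r ∷ r′)))
    sides = All.map (λ {s} → sameSide-sym {proj₁ s} {proj₂ s} {α} {η})
                    (sides-agree-R (proj₂ arcs) (proj₁ arcs) (proj₂ arcs) (AllPairs.head bf) (All.tail (all-evens _ nz)))
    avoids-α : All (_≢ α) (ζ ∷ r ∷ r′)
    avoids-α = vertices-after-first η (ζ ∷ r ∷ r′) lt (α≢β ∘ sym)
                 (All.map (λ inD → let (c∈ , e∈) = InD-in-P₂ (proj₁ inD) in P₂-avoids-α c∈ , P₂-avoids-α e∈) ev)

  R-shape : ∀ π → SrcR π → π ≡ α ∷ drop 1 π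
  R-shape []      ((_ , () , _) , _)
  R-shape (_ ∷ _) ((_ , refl , _) , _) = refl

  R-injective : ∀ π π′ → SrcR π → SrcR π′ → Rmap η π ≡ Rmap η π′ → π ≡ π′
  R-injective = replace-prefix-injective (α ∷ []) 1 η R-shape

  no-return : ∀ r → All (λ s → ¬ SameDiag (ζ , η) s) (steps (η ∷ r)) → at (η ∷ r) 1 ≢ just ζ
  no-return []      _          ()
  no-return (_ ∷ _) (fresh ∷ _) e = fresh (inj₂ (sym (just-injective e) , refl))

  ζη-fresh : ∀ r → All (_≢ η) r → at (η ∷ r) 1 ≢ just ζ → All (λ s → ¬ SameDiag (ζ , η) s) (steps (η ∷ r))
  ζη-fresh []        _     _     = []
  ζη-fresh (r₁ ∷ r′) avoid σ₂≢ζ =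
    (λ { (inj₁ (_ , e)) → All.head avoid (sym e) ; (inj₂ (e , _)) → σ₂≢ζ (cong just (sym e)) })
    ∷ All.map (_∘ sameDiag-swap) (steps-avoid (r₁ ∷ r′) avoid)

  -- For the rest η ∷ r of a T-path α ∷ ζ ∷ η ∷ r, α and η lie on the same side
  -- of every even step: the first one, {r₁, r₂}, avoids U₁ and η, and all
  -- later ones lie beyond it as seen from α, hence avoid η as well.
  sides-after-ζη : ∀ r → All Proper (steps (η ∷ r)) → AllPairs (λ s t → ¬ SameDiag s t) (steps (η ∷ r)) →
                   All (Before α (ζ , η)) (evens (steps (η ∷ r))) → AllPairs (Before α) (evens (steps (η ∷ r))) →
                   All (SidesAgree α η) (evens (steps (η ∷ r)))
  sides-after-ζη []           _                   _                 _                   _             = []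
  sides-after-ζη (_ ∷ [])     _                   _                 _                   _             = []
  sides-after-ζη (r₁ ∷ r₂ ∷ r) (η≢r₁ ∷ r₁≢r₂ ∷ nz) ((fresh ∷ _) ∷ _) (after₁ ∷ afters) (beyond₁ ∷ _) =
    side₁ ∷ All.zipWith (sides-agree-S ∘ clear) (All.zip (afters , beyond₁) , all-evens (steps (r₂ ∷ r)) nz)
    where
    off-U₁ : ∀ {t} → Before α (ζ , η) t → ¬ Btw< ζ (proj₁ t) η × ¬ Btw< ζ (proj₂ t) η
    off-U₁ = before-off-arc {p = ζ} {q = η} {x = α} hα
    side₁ : SidesAgree α η (r₁ , r₂)
    side₁ = sides-agree-S (proj₁ (off-U₁ after₁) , proj₂ (off-U₁ after₁) , η≢r₁ ∘ sym , (λ e → fresh (inj₂ (sym e , refl))) , r₁≢r₂)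
    clear : ∀ {t} → (Before α (ζ , η) t × Before α (r₁ , r₂) t) × Proper t → ClearOf ζ η η t
    clear ((after , beyond) , proper) with off-U₁ after | before-avoids {a = r₁} {b = r₂} {x = α} {y = η} side₁ beyond
    ... | c∉ , e∉ | c≢η , e≢η = c∉ , e∉ , c≢η , e≢η , proper

  after-ζη : ∀ {c e} → P₂ c → P₂ e → c ≢ η → e ≢ η → Before α (ζ , η) (c , e)
  after-ζη c∈ e∈ c≢η e≢η = not-ζη , not-α-side c∈ , not-α-side e∈
    where
    not-ζη : ¬ SameDiag (ζ , η) _
    not-ζη (inj₁ (_ , e)) = e≢η (sym e)
    not-ζη (inj₂ (_ , e)) = c≢η (sym e)
    not-α-side : ∀ {v} → P₂ v → ¬ SameSide ζ η α v
    not-α-side v∈ (inj₁ (_ , h)) = P₂-avoids-U₁ v∈ h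
    not-α-side v∈ (inj₂ (h , _)) = btw-asym {ζ} {α} {η} hα h

  S-maps : ∀ π → SrcS π → TgtS (Smap η π)
  S-maps []              ((_ , () , _) , _)
  S-maps (_ ∷ [])        (_ , () , _)
  S-maps (_ ∷ _ ∷ [])    (_ , _ , ())
  S-maps (_ ∷ _ ∷ _ ∷ r) ((_ , refl , lt , _ ∷ _ ∷ nz , _ ∷ fresh ∷ ds , _ ∷ _ ∷ nx , _ ∷ ev , after-ζη ∷ bf) , refl , refl) =
    (η≢β , refl , lt , nz , ds , nx , evenSteps-transport sides (ev , bf)) , no-return r fresh
    where
    sides : All (SidesAgree α η) (evens (steps (η ∷ r)))
    sides = sides-after-ζη r nz ds after-ζη bf

  S-onto : ∀ σ → TgtS σ → Σ (List (Fin n)) λ π → SrcS π × Smap η π ≡ σ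
  S-onto []      ((_ , () , _) , _)
  S-onto (_ ∷ r) ((_ , refl , lt , nz , ds , nx , ev , bf) , σ₂≢ζ) = (α ∷ ζ ∷ η ∷ r) , (path , refl , refl) , refl
    where
    -- the even steps of σ lie in D, hence in P₂, and cross {η, β}, hence avoid η
    in-P₂ : All (λ s → P₂ (proj₁ s) × P₂ (proj₂ s)) (evens (steps (η ∷ r)))
    in-P₂ = All.map (InD-in-P₂ ∘ proj₁) ev
    avoid-η : All (λ s → proj₁ s ≢ η × proj₂ s ≢ η) (evens (steps (η ∷ r)))
    avoid-η = All.map (cross-endpoints-≢ ∘ proj₂) ev
    clear : All (ClearOf ζ η η) (evens (steps (η ∷ r)))
    clear = All.zipWith (λ (((c∈ , e∈) , (c≢η , e≢η)) , proper) → P₂-avoids-U₁ c∈ , P₂-avoids-U₁ e∈ , c≢η , e≢η , proper)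
                        (All.zip (in-P₂ , avoid-η) , all-evens (steps (η ∷ r)) nz)
    transported : EvenStepsOK D α β (evens (steps (η ∷ r)))
    transported = evenSteps-transport (All.map (λ {s} → sameSide-sym {proj₁ s} {proj₂ s} {α} {η} ∘ sides-agree-S) clear) (ev , bf)
    after-ζη-all : All (Before α (ζ , η)) (evens (steps (η ∷ r)))
    after-ζη-all = All.zipWith (λ ((c∈ , e∈) , (c≢η , e≢η)) → after-ζη c∈ e∈ c≢η e≢η) (in-P₂ , avoid-η)
    avoids-α : All (_≢ α) r
    avoids-α = vertices-after-first η r lt (α≢β ∘ sym) (All.map (λ (c∈ , e∈) → P₂-avoids-α c∈ , P₂-avoids-α e∈) in-P₂)
    avoids-η : All (_≢ η) r
    avoids-η = vertices-after-first η r lt (η≢β ∘ sym) avoid-η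
    path : IsTPath D α β (α ∷ ζ ∷ η ∷ r)
    path = α≢β , refl , lt
         , α≢ζ ∷ ζ≢η ∷ nz
         , steps-avoid (ζ ∷ η ∷ r) ((α≢ζ ∘ sym) ∷ (α≢η ∘ sym) ∷ avoids-α) ∷ ζη-fresh r avoids-η σ₂≢ζ ∷ ds
         , αζ-noncrossing ∷ ζη-noncrossing ∷ nx
         , (ζη∈D , inj₁ (hα , hβ)) ∷ proj₁ transported
         , after-ζη-all ∷ proj₂ transported

  S-shape : ∀ π → SrcS π → π ≡ α ∷ ζ ∷ η ∷ drop 3 π
  S-shape []              ((_ , () , _) , _)
  S-shape (_ ∷ [])        (_ , () , _)
  S-shape (_ ∷ _ ∷ [])    (_ , _ , ())
  S-shape (_ ∷ _ ∷ _ ∷ _) ((_ , refl , _) , refl , refl) = refl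

  S-injective : ∀ π π′ → SrcS π → SrcS π′ → Smap η π ≡ Smap η π′ → π ≡ π′
  S-injective = replace-prefix-injective (α ∷ ζ ∷ η ∷ []) 3 η S-shape

  module _ {c : Level} (K : Semifield c) (f : Diag n → Semifield.Carrier K) where
    open Semifield K

    R-weight : ∀ π → IsTPath D α β π → at π 1 ≡ just ζ → at π 2 ≢ just η →
               (fp K f α ζ / fp K f η ζ) * weight K f (Rmap η π) ≡ weight K f π
    R-weight []          (_ , () , _) _    _
    R-weight (_ ∷ [])    _            ()   _
    R-weight (_ ∷ _ ∷ r) (_ , refl , _) refl _ = weight-reroot K f α η ζ r

    S-weight : ∀ π → IsTPath D α β π → at π 1 ≡ just ζ → at π 2 ≡ just η →
               (fp K f α ζ / fp K f ζ η) * weight K f (Smap η π) ≡ weight K f π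
    S-weight []              (_ , () , _) _    _
    S-weight (_ ∷ [])        _            ()   _
    S-weight (_ ∷ _ ∷ [])    _            _    ()
    S-weight (_ ∷ _ ∷ _ ∷ r) (_ , refl , _) refl refl = weight-prepend₂ K f α ζ η r

lemma3p8 : {c : Level} (K : Semifield c) (n : ℕ) → 3 ≤ n →
    (ζ η : Fin n) → ζ ≢ η →
    (D D₂ : Diag n → Set) →
    IsDissection AllV D →
    IsDissection (λ v → Btw≤ η v ζ) D₂ →
    (∀ e → D e → SameDiag (endpts e) (ζ , η) ⊎ D₂ e) →
    (∀ e → SameDiag (endpts e) (ζ , η) ⊎ D₂ e → D e) →
    (∀ e → D₂ e → ¬ SameDiag (endpts e) (ζ , η)) →
    (α β : Fin n) → Btw< ζ α η → Btw< η β ζ →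
    (f : Diag n → Semifield.Carrier K) →
    let open Semifield K in
    -- (i)
    (BijectsOn
      (λ π → IsTPath D α β π × at π 1 ≡ just ζ × at π 2 ≢ just η)
      (λ ρ → IsTPath D η β ρ × at ρ 1 ≡ just ζ)
      (Rmap η)
    × (∀ π → IsTPath D α β π → at π 1 ≡ just ζ → at π 2 ≢ just η →
         (fp K f α ζ / fp K f η ζ) * weight K f (Rmap η π) ≡ weight K f π))
    -- (ii)
    × (BijectsOn
      (λ π → IsTPath D α β π × at π 1 ≡ just ζ × at π 2 ≡ just η)
      (λ σ → IsTPath D η β σ × at σ 1 ≢ just ζ)
      (Smap η)
    × (∀ π → IsTPath D α β π → at π 1 ≡ just ζ → at π 2 ≡ just η →
         (fp K f α ζ / fp K f ζ η) * weight K f (Smap η π) ≡ weight K f π))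
lemma3p8 K n _ ζ η ζ≢η D D₂ dD dD₂ toD fromD _ α β hα hβ f =
  ((R-maps , R-injective , R-onto) , R-weight K f) , ((S-maps , S-injective , S-onto) , S-weight K f)
  where open Configuration ζ η ζ≢η D D₂ dD dD₂ toD fromD α β hα hβ
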